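{- Let $n\ge 1$ and let $A$ be an $n\times n$ alternating sign matrix. Then its term rank satisfies $$\rho(A)\ge \left\lceil 2\sqrt{n+1}-2\right\rceil.$$
   Context: An alternating sign matrix (ASM) is an $n\times n$ matrix with entries in $\{0,+1,-1\}$ such that in each row and each column the nonzero entries alternate in sign, beginning and ending with $+1$. The term rank $\rho(X)$ of a matrix $X$ is the maximum number of nonzero entries of $X$ no two of which lie in the same row or column (equivalently, the minimum number of rows and columns that together contain all nonzero entries of $X$). -}

module Defs where

open import Data.Nat using (ℕ; _≤_)
open import Data.Integer using (ℤ; +_; -[1+_]; 0ℤ; 1ℤ)
import Data.Integer as ℤ
open import Data.Fin using (Fin)
open import Data.List using (List; []; _∷_; filter)
open import Data.Product using (Σ; _×_; ∃)
open import Data.Sum using (_⊎_)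
open import Data.Vec.Functional using (toList)
open import Relation.Nullary using (¬_)
open import Relation.Nullary.Decidable using (¬?)
open import Relation.Binary.PropositionalEquality using (_≡_)
open import Function.Definitions using (Injective)

Matrix : ℕ → Set
Matrix n = Fin n → Fin n → ℤ

EntriesIn01m1 : ∀ {n} → Matrix n → Set
EntriesIn01m1 {n} A = ∀ (i j : Fin n) → (A i j ≡ 0ℤ) ⊎ (A i j ≡ 1ℤ) ⊎ (A i j ≡ -[1+ 0 ])

data AltSigns : List ℤ → Set where
  alt-one  : AltSigns (1ℤ ∷ [])
  alt-step : ∀ {xs} → AltSigns xs → AltSigns (1ℤ ∷ -[1+ 0 ] ∷ xs)

nonzeros : List ℤ → List ℤ
nonzeros = filter (λ x → ¬? (x ℤ.≟ 0ℤ))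

row : ∀ {n} → Matrix n → Fin n → List ℤ
row A i = toList (λ j → A i j)

col : ∀ {n} → Matrix n → Fin n → List ℤ
col A j = toList (λ i → A i j)

IsASM : ∀ {n} → Matrix n → Set
IsASM {n} A =
  EntriesIn01m1 A
  × (∀ (i : Fin n) → AltSigns (nonzeros (row A i)))
  × (∀ (j : Fin n) → AltSigns (nonzeros (col A j)))

NonzeroPartialTransversal : ∀ {n} → Matrix n → ℕ → Set
NonzeroPartialTransversal {n} A k =
  Σ (Fin k → Fin n) λ r → Σ (Fin k → Fin n) λ c →
    Injective _≡_ _≡_ r × Injective _≡_ _≡_ c × (∀ t → ¬ (A (r t) (c t) ≡ 0ℤ))

IsTermRank : ∀ {n} → Matrix n → ℕ → Set
IsTermRank A ρ = NonzeroPartialTransversal A ρ × (∀ k → NonzeroPartialTransversal A k → k ≤ ρ)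

-- Let ρ be the term rank. By König's theorem the nonzero entries of A are covered by e rows
-- and f columns with e + f ≤ ρ. Summing A over the n − f uncovered columns gives n − f, as
-- every column sums to 1; an uncovered row contributes nothing to that sum, and a covered row
-- at most 1 + f, as its entries sum to 1 and are ≥ −1. Hence n + 1 ≤ (e + 1)(f + 1), and by
-- AM–GM 4(n + 1) ≤ (e + f + 2)² ≤ (ρ + 2)².
-- König's theorem is proved with alternating paths from a maximum matching. Reachability along
-- them is decidable only classically, which suffices because the conclusion is decidable.
module Submission where

open import Defs
open import Data.Fin using (Fin; zero; suc; _≟_)
open import Data.Fin.Properties using (any?)
open import Data.Bool using (Bool; true; false; not)
import Data.Bool.Properties as Bool
open import Data.Product using (Σ; ∃; _×_; _,_)
open import Data.Sum using (_⊎_; inj₁; inj₂; [_,_]′)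
open import Function using (_∘_)
open import Function.Definitions using (Injective)
open import Relation.Nullary using (¬_; Dec; yes; no; does; contradiction)
open import Relation.Nullary.Decidable using (_×-dec_; dec-true; dec-false)
open import Relation.Binary.PropositionalEquality
import Algebra.Properties.Semiring.Sum as SemiringSum

module Counting where

  open import Data.Nat using (ℕ; zero; suc; _+_; _*_; _≤_; z≤n)
  open import Data.Nat.Properties
    using (+-*-semiring; ≤-trans; ≤-reflexive; +-mono-≤; m≤m+n; m≤n+m; *-identityʳ; module ≤-Reasoning)
  module ℕΣ = SemiringSum +-*-semiring

  𝟙 : Bool → ℕ
  𝟙 false = 0
  𝟙 true  = 1

  count : ∀ {k} → (Fin k → Bool) → ℕ
  count S = ℕΣ.sum (𝟙 ∘ S)

  sum-ones : ∀ k → ℕΣ.sum {k} (λ _ → 1) ≡ k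
  sum-ones zero    = refl
  sum-ones (suc k) = cong suc (sum-ones k)

  count-not+count : ∀ {k} (S : Fin k → Bool) → count (not ∘ S) + count S ≡ k
  count-not+count {k} S = begin
    count (not ∘ S) + count S               ≡⟨ ℕΣ.∑-distrib-+ (𝟙 ∘ not ∘ S) (𝟙 ∘ S) ⟨
    ℕΣ.sum (λ t → 𝟙 (not (S t)) + 𝟙 (S t)) ≡⟨ ℕΣ.sum-cong-≗ (λ t → 𝟙-not+𝟙 (S t)) ⟩
    ℕΣ.sum {k} (λ _ → 1)                    ≡⟨ sum-ones k ⟩
    k                                       ∎
    where
      open ≡-Reasoning
      𝟙-not+𝟙 : ∀ b → 𝟙 (not b) + 𝟙 b ≡ 1
      𝟙-not+𝟙 false = refl
      𝟙-not+𝟙 true  = refl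

  ℕΣ-mono-≤ : ∀ {k} {f g : Fin k → ℕ} → (∀ t → f t ≤ g t) → ℕΣ.sum f ≤ ℕΣ.sum g
  ℕΣ-mono-≤ {zero}  _   = z≤n
  ℕΣ-mono-≤ {suc _} f≤g = +-mono-≤ (f≤g zero) (ℕΣ-mono-≤ (f≤g ∘ suc))

  term≤ℕΣ : ∀ {k} (f : Fin k → ℕ) t → f t ≤ ℕΣ.sum f
  term≤ℕΣ f zero    = m≤m+n (f zero) _
  term≤ℕΣ f (suc t) = ≤-trans (term≤ℕΣ (f ∘ suc) t) (m≤n+m _ (f zero))

  ℕΣ-δ : ∀ {m} (i : Fin m) → ℕΣ.sum (λ j → 𝟙 (does (i ≟ j))) ≡ 1
  ℕΣ-δ {suc m} zero    = cong suc (ℕΣ.sum-replicate-zero m)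
  ℕΣ-δ {suc m} (suc i) = ℕΣ-δ i

  image : ∀ {k m} → (Fin k → Bool) → (Fin k → Fin m) → Fin m → Bool
  image S g j = does (any? λ t → (S t Bool.≟ true) ×-dec (g t ≟ j))

  image-true : ∀ {k m} {S : Fin k → Bool} (g : Fin k → Fin m) {t} → S t ≡ true → image S g (g t) ≡ true
  image-true g {t} St = dec-true (any? _) (t , St , refl)

  count-image≤count : ∀ {k m} (S : Fin k → Bool) (g : Fin k → Fin m) → count (image S g) ≤ count S
  count-image≤count S g = begin
    count (image S g)                                          ≤⟨ ℕΣ-mono-≤ image≤incidences ⟩
    ℕΣ.sum (λ j → ℕΣ.sum (λ t → 𝟙 (S t) * 𝟙 (does (g t ≟ j)))) ≡⟨ ℕΣ.∑-comm (λ t j → 𝟙 (S t) * 𝟙 (does (g t ≟ j))) ⟨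
    ℕΣ.sum (λ t → ℕΣ.sum (λ j → 𝟙 (S t) * 𝟙 (does (g t ≟ j)))) ≡⟨ ℕΣ.sum-cong-≗ incidences-of ⟩
    count S                                                    ∎
    where
      open ≤-Reasoning
      image≤incidences : ∀ j → 𝟙 (image S g j) ≤ ℕΣ.sum (λ t → 𝟙 (S t) * 𝟙 (does (g t ≟ j)))
      image≤incidences j with any? (λ t → (S t Bool.≟ true) ×-dec (g t ≟ j))
      ... | no  _               = z≤n
      ... | yes (t , St , refl) = ≤-trans (≤-reflexive (sym incidence)) (term≤ℕΣ _ t)
        where
          incidence : 𝟙 (S t) * 𝟙 (does (g t ≟ g t)) ≡ 1
          incidence rewrite St | dec-true (g t ≟ g t) refl = refl
      incidences-of : ∀ t → ℕΣ.sum (λ j → 𝟙 (S t) * 𝟙 (does (g t ≟ j))) ≡ 𝟙 (S t)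
      incidences-of t = begin-equality
        ℕΣ.sum (λ j → 𝟙 (S t) * 𝟙 (does (g t ≟ j))) ≡⟨ ℕΣ.*-distribˡ-sum (𝟙 (S t)) (λ j → 𝟙 (does (g t ≟ j))) ⟨
        𝟙 (S t) * ℕΣ.sum (λ j → 𝟙 (does (g t ≟ j))) ≡⟨ cong (𝟙 (S t) *_) (ℕΣ-δ (g t)) ⟩
        𝟙 (S t) * 1                                 ≡⟨ *-identityʳ _ ⟩
        𝟙 (S t)                                     ∎

module Matchings where

  open import Data.Nat using (ℕ; zero; suc)
  import Data.Vec.Functional as Vector
  open import Data.List using (List; []; _∷_)
  open import Data.List.Membership.Propositional using (_∈_; _∉_)
  open import Data.List.Membership.DecPropositional using () renaming (_∈?_ to member?)
  open import Data.List.Relation.Unary.Any using (here; there)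
  open import Relation.Nullary.Decidable using (¬¬-excluded-middle)

  Matching : ∀ {m n} → (Fin m → Fin n → Set) → ℕ → Set
  Matching {m} {n} E k =
    Σ (Fin k → Fin m) λ r → Σ (Fin k → Fin n) λ c →
      Injective _≡_ _≡_ r × Injective _≡_ _≡_ c × (∀ t → E (r t) (c t))

  ∷-injective : ∀ {A : Set} {k} {x : A} {f : Fin k → A} →
                (∀ t → f t ≢ x) → Injective _≡_ _≡_ f → Injective _≡_ _≡_ (x Vector.∷ f)
  ∷-injective {x = x} {f} x∉f f-inj = inj
    where
      inj : Injective _≡_ _≡_ (x Vector.∷ f)
      inj {zero}  {zero}  _  = refl
      inj {zero}  {suc t} eq = contradiction (sym eq) (x∉f t)
      inj {suc s} {zero}  eq = contradiction eq (x∉f s)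
      inj {suc s} {suc t} eq = cong suc (f-inj eq)

  ¬¬-pull-Fin : ∀ {k p} {P : Fin k → Set p} → (∀ t → ¬ ¬ P t) → ¬ ¬ (∀ t → P t)
  ¬¬-pull-Fin {zero}  _   ¬∀P = ¬∀P λ ()
  ¬¬-pull-Fin {suc _} ¬¬P ¬∀P =
    ¬¬P zero λ p₀ → ¬¬-pull-Fin (¬¬P ∘ suc) λ ps → ¬∀P λ { zero → p₀ ; (suc t) → ps t }

  module _ {k n} (c : Fin k → Fin n) where

    rematch : Fin k → Fin n → Fin k → Fin n
    rematch t j s with s ≟ t
    ... | yes _ = j
    ... | no  _ = c s

    rematch-injective : ∀ {t j} → Injective _≡_ _≡_ c → (∀ s → c s ≢ j) → Injective _≡_ _≡_ (rematch t j)
    rematch-injective {t} c-injective j∉c {s} {s′} eq with s ≟ t | s′ ≟ t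
    ... | yes s≡t | yes s′≡t = trans s≡t (sym s′≡t)
    ... | yes _   | no  _    = contradiction (sym eq) (j∉c s′)
    ... | no  _   | yes _    = contradiction eq (j∉c s)
    ... | no  _   | no  _    = c-injective eq

    rematch-frees : ∀ {t j} → Injective _≡_ _≡_ c → (∀ s → c s ≢ j) → ∀ s → rematch t j s ≢ c t
    rematch-frees {t} c-injective j∉c s eq with s ≟ t
    ... | yes _   = j∉c t (sym eq)
    ... | no  s≢t = s≢t (c-injective eq)

    rematch-agrees : ∀ {t j ts} → t ∉ ts → ∀ s → s ∈ ts → c s ≡ rematch t j s
    rematch-agrees {t} t∉ s s∈ with s ≟ t
    ... | yes refl = contradiction s∈ t∉
    ... | no  _    = refl

  module AlternatingPaths {m n ρ} {E : Fin m → Fin n → Set}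
    (r : Fin ρ → Fin m) (r-injective : Injective _≡_ _≡_ r) where

    Exposed : Fin m → Set
    Exposed i = ∀ t → r t ≢ i

    -- AltPath c i ts: an alternating path from an exposed row to row i whose
    -- matched edges (r t, c t) are listed, last first, in ts.
    data AltPath (c : Fin ρ → Fin n) : Fin m → List (Fin ρ) → Set where
      start : ∀ {i} → Exposed i → AltPath c i []
      step  : ∀ {i ts t} → AltPath c i ts → E i (c t) → t ∉ ts → AltPath c (r t) (t ∷ ts)

    Reachable : (Fin ρ → Fin n) → Fin m → Set
    Reachable c i = ∃ (AltPath c i)

    AltPath-transport : ∀ {c c′ i ts} → (∀ t → t ∈ ts → c t ≡ c′ t) → AltPath c i ts → AltPath c′ i ts
    AltPath-transport agree (start exposed) = start exposed
    AltPath-transport agree (step {i} p e t∉) =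
      step (AltPath-transport (λ s → agree s ∘ there) p) (subst (E i) (agree _ (here refl)) e) t∉

    reachable-on-path : ∀ {c i ts t} → AltPath c i ts → t ∈ ts → Reachable c (r t)
    reachable-on-path (step p e t∉) (here refl) = _ , step p e t∉
    reachable-on-path (step p e t∉) (there t∈) = reachable-on-path p t∈

    augment : ∀ {c i ts j} → Injective _≡_ _≡_ c → (∀ t → E (r t) (c t)) →
              AltPath c i ts → E i j → (∀ t → c t ≢ j) → Matching E (suc ρ)
    augment {c} {i} {j = j} c-inj matched (start exposed) e j∉c =
      i Vector.∷ r , j Vector.∷ c , ∷-injective exposed r-injective , ∷-injective j∉c c-inj ,
      λ { zero → e ; (suc t) → matched t }
    augment {c} {j = j} c-inj matched (step {t = t} p e t∉) e′ j∉c =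
      augment (rematch-injective c c-inj j∉c) matched′
        (AltPath-transport (rematch-agrees c t∉) p) e (rematch-frees c c-inj j∉c)
      where
        matched′ : ∀ s → E (r s) (rematch c t j s)
        matched′ s with s ≟ t
        ... | yes refl = e′
        ... | no  _    = matched s

  -- side t chooses the row r t (false) or the column c t (true) of the matched edge t
  EndpointCover : ∀ {m n ρ} (E : Fin m → Fin n → Set) → (Fin ρ → Fin m) → (Fin ρ → Fin n) →
                  (Fin ρ → Bool) → Set
  EndpointCover {m} {n} E r c side = ∀ (i : Fin m) (j : Fin n) → E i j →
    (∃ λ t → side t ≡ false × r t ≡ i) ⊎ (∃ λ t → side t ≡ true × c t ≡ j)

  module _ {m n ρ} {E : Fin m → Fin n → Set}
    (r : Fin ρ → Fin m) (c : Fin ρ → Fin n)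
    (r-injective : Injective _≡_ _≡_ r) (c-injective : Injective _≡_ _≡_ c)
    (matched : ∀ t → E (r t) (c t)) (maximum : ¬ Matching E (suc ρ)) where

    open AlternatingPaths {E = E} r r-injective

    module _ (reachable? : ∀ t → Dec (Reachable c (r t))) where

      side : Fin ρ → Bool
      side t = does (reachable? t)

      -- j is matched, else p augments; its row is reachable by extending p if not already on it
      reachable-column : ∀ {i j} → Reachable c i → E i j → ∃ λ t → side t ≡ true × c t ≡ j
      reachable-column {i} {j} (ts , p) e with any? (λ t → c t ≟ j)
      ... | no  j∉c          = contradiction (augment c-injective matched p e (λ t eq → j∉c (t , eq))) maximum
      ... | yes (t , ct≡j) = t , dec-true (reachable? t) reachable-rt , ct≡j
        where
          reachable-rt : Reachable c (r t)
          reachable-rt with member? _≟_ t ts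
          ... | yes t∈ = reachable-on-path p t∈
          ... | no  t∉ = _ , step p (subst (E i) (sym ct≡j) e) t∉

      side-covers : EndpointCover E r c side
      side-covers i j e with any? (λ t → r t ≟ i)
      ... | no  i∉r        = inj₂ (reachable-column (_ , start (λ t eq → i∉r (t , eq))) e)
      ... | yes (t , rt≡i) with reachable? t
      ...   | no  ¬p           = inj₁ (t , dec-false (reachable? t) ¬p , rt≡i)
      ...   | yes (ts , p)     = inj₂ (reachable-column (ts , subst (λ x → AltPath c x ts) rt≡i p) e)

    maximum-matching-cover : ¬ ¬ ∃ (EndpointCover E r c)
    maximum-matching-cover ¬cover =
      ¬¬-pull-Fin (λ _ → ¬¬-excluded-middle) λ reachable? → ¬cover (_ , side-covers reachable?)

module LineSums where

  open Counting using (𝟙; count; count-not+count; module ℕΣ)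
  open import Data.Nat as ℕ using (ℕ; zero; suc)
  open import Data.Integer as ℤ using (ℤ; +_; 0ℤ; 1ℤ; -1ℤ; _+_; _*_; _≤_)
  open import Data.Integer.Properties
    using ( +-*-semiring; ≤-refl; ≤-reflexive; +-mono-≤; +-monoˡ-≤; +-identityˡ; +-identityʳ
          ; *-identityˡ; *-identityʳ; *-zeroˡ; pos-+; pos-*; drop‿+≤+; module ≤-Reasoning)
  open import Data.Integer.Tactic.RingSolver using (solve-∀)
  open import Data.List using (List; []; _∷_; foldr)
  import Data.List.Properties as List
  open import Data.Vec.Functional using (toList)
  open import Relation.Nullary.Decidable using (¬?)
  module ℤΣ = SemiringSum +-*-semiring

  sumList : List ℤ → ℤ
  sumList = foldr _+_ 0ℤ

  sumList-toList : ∀ {k} (f : Fin k → ℤ) → sumList (toList f) ≡ ℤΣ.sum f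
  sumList-toList {zero}  f = refl
  sumList-toList {suc k} f = cong (_+_ (f zero)) (sumList-toList (f ∘ suc))

  private
    nonzero? : (x : ℤ) → Dec (¬ x ≡ 0ℤ)
    nonzero? x = ¬? (x ℤ.≟ 0ℤ)

  sumList-nonzeros : ∀ xs → sumList (nonzeros xs) ≡ sumList xs
  sumList-nonzeros []       = refl
  sumList-nonzeros (x ∷ xs) = by-cases (x ℤ.≟ 0ℤ)
    where
      open ≡-Reasoning
      by-cases : Dec (x ≡ 0ℤ) → sumList (nonzeros (x ∷ xs)) ≡ sumList (x ∷ xs)
      by-cases (yes refl) = begin
        sumList (nonzeros (0ℤ ∷ xs)) ≡⟨ cong sumList (List.filter-reject nonzero? {xs = xs} (λ ≢0 → ≢0 refl)) ⟩
        sumList (nonzeros xs)        ≡⟨ sumList-nonzeros xs ⟩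
        sumList xs                   ≡⟨ +-identityˡ (sumList xs) ⟨
        0ℤ + sumList xs              ∎
      by-cases (no x≢0) = begin
        sumList (nonzeros (x ∷ xs)) ≡⟨ cong sumList (List.filter-accept nonzero? {xs = xs} x≢0) ⟩
        x + sumList (nonzeros xs)   ≡⟨ cong (_+_ x) (sumList-nonzeros xs) ⟩
        x + sumList xs              ∎

  sumList-AltSigns : ∀ {xs} → AltSigns xs → sumList xs ≡ 1ℤ
  sumList-AltSigns alt-one = refl
  sumList-AltSigns (alt-step alt) rewrite sumList-AltSigns alt = refl

  sum≡1 : ∀ {k} (f : Fin k → ℤ) → AltSigns (nonzeros (toList f)) → ℤΣ.sum f ≡ 1ℤ
  sum≡1 f alt = begin
    ℤΣ.sum f                     ≡⟨ sumList-toList f ⟨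
    sumList (toList f)           ≡⟨ sumList-nonzeros (toList f) ⟨
    sumList (nonzeros (toList f)) ≡⟨ sumList-AltSigns alt ⟩
    1ℤ                           ∎
    where open ≡-Reasoning

  LineCover : ∀ {n} → Matrix n → (Fin n → Bool) → (Fin n → Bool) → Set
  LineCover {n} A R C = ∀ (i j : Fin n) → ¬ A i j ≡ 0ℤ → R i ≡ true ⊎ C j ≡ true

  ι : Bool → ℤ
  ι b = + 𝟙 b

  ℤΣ-pos : ∀ {k} (f : Fin k → ℕ) → ℤΣ.sum (λ t → + f t) ≡ + ℕΣ.sum f
  ℤΣ-pos {zero}  f = refl
  ℤΣ-pos {suc k} f = trans (cong (_+_ (+ f zero)) (ℤΣ-pos (f ∘ suc))) (sym (pos-+ (f zero) _))

  ℤΣ-mono-≤ : ∀ {k} {f g : Fin k → ℤ} → (∀ t → f t ≤ g t) → ℤΣ.sum f ≤ ℤΣ.sum g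
  ℤΣ-mono-≤ {zero}  _   = ≤-refl
  ℤΣ-mono-≤ {suc _} f≤g = +-mono-≤ (f≤g zero) (ℤΣ-mono-≤ (f≤g ∘ suc))

  -- an entry outside the covered columns contributes only in a covered row, and there at most a + 1
  covered-entry : ∀ {a} (ρ γ : Bool) → -1ℤ ≤ a → (¬ a ≡ 0ℤ → ρ ≡ true ⊎ γ ≡ true) →
                  ι (not γ) * a ≤ ι ρ * (a + ι γ)
  covered-entry {a} true  true  -1≤a _ = begin
    0ℤ * a         ≡⟨ *-zeroˡ a ⟩
    0ℤ             ≤⟨ +-monoˡ-≤ 1ℤ -1≤a ⟩
    a + 1ℤ         ≡⟨ *-identityˡ (a + 1ℤ) ⟨
    1ℤ * (a + 1ℤ)  ∎
    where open ≤-Reasoning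
  covered-entry {a} true  false _ _ = ≤-reflexive (cong (_*_ 1ℤ) (sym (+-identityʳ a)))
  covered-entry {a} false true  _ _ = ≤-reflexive (trans (*-zeroˡ a) (sym (*-zeroˡ (a + 1ℤ))))
  covered-entry {a} false false _ covered with a ℤ.≟ 0ℤ
  ... | yes refl = ≤-refl
  ... | no  a≢0  with covered a≢0
  ...   | inj₁ ()
  ...   | inj₂ ()

  module _ {n} (A : Matrix n)
    (row-sum : ∀ i → ℤΣ.sum (λ j → A i j) ≡ 1ℤ) (col-sum : ∀ j → ℤΣ.sum (λ i → A i j) ≡ 1ℤ)
    (≥-1 : ∀ i j → -1ℤ ≤ A i j) where

    line-cover-bound : ∀ R C → LineCover A R C → n ℕ.+ 1 ℕ.≤ (count R ℕ.+ 1) ℕ.* (count C ℕ.+ 1)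
    line-cover-bound R C cover = drop‿+≤+ (begin
      + (n ℕ.+ 1)                        ≡⟨ pos-+ n 1 ⟩
      + n + 1ℤ                           ≡⟨ cong (λ k → + k + 1ℤ) (count-not+count C) ⟨
      + (count (not ∘ C) ℕ.+ f) + 1ℤ     ≡⟨ cong (_+ 1ℤ) (pos-+ (count (not ∘ C)) f) ⟩
      + count (not ∘ C) + + f + 1ℤ       ≤⟨ +-monoˡ-≤ 1ℤ (+-monoˡ-≤ (+ f) uncovered-columns) ⟩
      + e * (1ℤ + + f) + + f + 1ℤ        ≡⟨ factor (+ e) (+ f) ⟩
      (+ e + 1ℤ) * (+ f + 1ℤ)            ≡⟨ cong₂ _*_ (pos-+ e 1) (pos-+ f 1) ⟨
      + (e ℕ.+ 1) * + (f ℕ.+ 1)          ≡⟨ pos-* (e ℕ.+ 1) (f ℕ.+ 1) ⟨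
      + ((e ℕ.+ 1) ℕ.* (f ℕ.+ 1))        ∎)
      where
        open ≤-Reasoning
        e f : ℕ
        e = count R
        f = count C
        factor : ∀ x y → x * (1ℤ + y) + y + 1ℤ ≡ (x + 1ℤ) * (y + 1ℤ)
        factor = solve-∀
        row-bound : ∀ i → ℤΣ.sum (λ j → ι (not (C j)) * A i j) ≤ ι (R i) * (1ℤ + + f)
        row-bound i = begin
          ℤΣ.sum (λ j → ι (not (C j)) * A i j)     ≤⟨ ℤΣ-mono-≤ (λ j → covered-entry (R i) (C j) (≥-1 i j) (cover i j)) ⟩
          ℤΣ.sum (λ j → ι (R i) * (A i j + ι (C j))) ≡⟨ ℤΣ.*-distribˡ-sum (ι (R i)) (λ j → A i j + ι (C j)) ⟨
          ι (R i) * ℤΣ.sum (λ j → A i j + ι (C j))   ≡⟨ cong (_*_ (ι (R i))) (ℤΣ.∑-distrib-+ (A i) (ι ∘ C)) ⟩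
          ι (R i) * (ℤΣ.sum (A i) + ℤΣ.sum (ι ∘ C))  ≡⟨ cong₂ (λ x y → ι (R i) * (x + y)) (row-sum i) (ℤΣ-pos (𝟙 ∘ C)) ⟩
          ι (R i) * (1ℤ + + f)                        ∎
        uncovered-columns : + count (not ∘ C) ≤ + e * (1ℤ + + f)
        uncovered-columns = begin
          + count (not ∘ C)                                    ≡⟨ ℤΣ-pos (𝟙 ∘ not ∘ C) ⟨
          ℤΣ.sum (λ j → ι (not (C j)))                         ≡⟨ ℤΣ.sum-cong-≗ (λ j → trans (sym (*-identityʳ _)) (cong (_*_ (ι (not (C j)))) (sym (col-sum j)))) ⟩
          ℤΣ.sum (λ j → ι (not (C j)) * ℤΣ.sum (λ i → A i j))  ≡⟨ ℤΣ.sum-cong-≗ (λ j → ℤΣ.*-distribˡ-sum (ι (not (C j))) (λ i → A i j)) ⟩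
          ℤΣ.sum (λ j → ℤΣ.sum (λ i → ι (not (C j)) * A i j))  ≡⟨ ℤΣ.∑-comm (λ i j → ι (not (C j)) * A i j) ⟨
          ℤΣ.sum (λ i → ℤΣ.sum (λ j → ι (not (C j)) * A i j))  ≤⟨ ℤΣ-mono-≤ row-bound ⟩
          ℤΣ.sum (λ i → ι (R i) * (1ℤ + + f))                  ≡⟨ ℤΣ.*-distribʳ-sum (1ℤ + + f) (ι ∘ R) ⟨
          ℤΣ.sum (ι ∘ R) * (1ℤ + + f)                          ≡⟨ cong (_* (1ℤ + + f)) (ℤΣ-pos (𝟙 ∘ R)) ⟩
          + e * (1ℤ + + f)                                     ∎

open import Data.Nat using (ℕ; suc; _+_; _*_; _≤_; _≤?_)
open import Data.Nat.Properties
  using ( ≤-total; *-comm; +-comm; m≤n⇒∃[o]m+o≡n; m≤m+n; +-mono-≤; +-monoˡ-≤; *-mono-≤; *-monoʳ-≤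
        ; 1+n≰n; module ≤-Reasoning)
open import Data.Nat.Tactic.RingSolver using (solve-∀)
open import Data.Integer as ℤ using (0ℤ; 1ℤ; -1ℤ; -[1+_]; -≤+)
import Data.Integer.Properties as ℤ
open import Relation.Nullary.Decidable using (decidable-stable)
open import Relation.Nullary.Negation using (¬¬-map)
open Counting using (count; image; image-true; count-image≤count; count-not+count)
open Matchings using (EndpointCover; maximum-matching-cover)
open LineSums using (sum≡1; line-cover-bound)

4*m*n≤[m+n]² : ∀ m n → 4 * (m * n) ≤ (m + n) * (m + n)
4*m*n≤[m+n]² m n = [ ordered , swapped ]′ (≤-total m n)
  where
    square-gap : ∀ m d → (m + (m + d)) * (m + (m + d)) ≡ 4 * (m * (m + d)) + d * d
    square-gap = solve-∀
    ordered : ∀ {m n} → m ≤ n → 4 * (m * n) ≤ (m + n) * (m + n)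
    ordered {m} m≤n with d , refl ← m≤n⇒∃[o]m+o≡n m≤n =
      subst (4 * (m * (m + d)) ≤_) (sym (square-gap m d)) (m≤m+n _ _)
    swapped : n ≤ m → 4 * (m * n) ≤ (m + n) * (m + n)
    swapped n≤m = subst₂ _≤_ (cong (4 *_) (*-comm n m)) (cong (λ k → k * k) (+-comm n m)) (ordered n≤m)

square-bound : ∀ {n e f ρ} → n + 1 ≤ (e + 1) * (f + 1) → e + f ≤ ρ → 4 * (n + 1) ≤ (ρ + 2) * (ρ + 2)
square-bound {n} {e} {f} {ρ} n+1≤ e+f≤ρ = begin
  4 * (n + 1)                           ≤⟨ *-monoʳ-≤ 4 n+1≤ ⟩
  4 * ((e + 1) * (f + 1))               ≤⟨ 4*m*n≤[m+n]² (e + 1) (f + 1) ⟩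
  (e + 1 + (f + 1)) * (e + 1 + (f + 1)) ≡⟨ cong (λ k → k * k) (regroup e f) ⟩
  (e + f + 2) * (e + f + 2)             ≤⟨ *-mono-≤ e+f+2≤ρ+2 e+f+2≤ρ+2 ⟩
  (ρ + 2) * (ρ + 2)                     ∎
  where
    open ≤-Reasoning
    regroup : ∀ e f → e + 1 + (f + 1) ≡ e + f + 2
    regroup = solve-∀
    e+f+2≤ρ+2 : e + f + 2 ≤ ρ + 2
    e+f+2≤ρ+2 = +-monoˡ-≤ 2 e+f≤ρ

EndpointCover⇒image-cover : ∀ {m n ρ} {E : Fin m → Fin n → Set} {r c} {side : Fin ρ → Bool} →
  EndpointCover E r c side → ∀ i j → E i j → image (not ∘ side) r i ≡ true ⊎ image side c j ≡ true
EndpointCover⇒image-cover {r = r} {c} cover i j e with cover i j e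
... | inj₁ (t , side-t , refl) = inj₁ (image-true r (cong not side-t))
... | inj₂ (t , side-t , refl) = inj₂ (image-true c side-t)

count-endpoint-images≤ : ∀ {m n ρ} (side : Fin ρ → Bool) (r : Fin ρ → Fin m) (c : Fin ρ → Fin n) →
  count (image (not ∘ side) r) + count (image side c) ≤ ρ
count-endpoint-images≤ {ρ = ρ} side r c = begin
  count (image (not ∘ side) r) + count (image side c) ≤⟨ +-mono-≤ (count-image≤count (not ∘ side) r) (count-image≤count side c) ⟩
  count (not ∘ side) + count side                     ≡⟨ count-not+count side ⟩
  ρ                                                   ∎
  where open ≤-Reasoning

entry≥-1 : ∀ {a} → (a ≡ 0ℤ) ⊎ (a ≡ 1ℤ) ⊎ (a ≡ -[1+ 0 ]) → -1ℤ ℤ.≤ a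
entry≥-1 (inj₁ refl)        = -≤+
entry≥-1 (inj₂ (inj₁ refl)) = -≤+
entry≥-1 (inj₂ (inj₂ refl)) = ℤ.≤-refl

theorem4p1 : ∀ (n : ℕ) → 1 ≤ n → (A : Matrix n) → IsASM A →
    ∀ (ρ : ℕ) → IsTermRank A ρ → 4 * (n + 1) ≤ (ρ + 2) * (ρ + 2)
theorem4p1 n _ A (entries , rows , cols) ρ ((r , c , r-injective , c-injective , nonzero) , maximal) =
  decidable-stable (_ ≤? _)
    (¬¬-map bound (maximum-matching-cover r c r-injective c-injective nonzero maximum))
  where
    maximum : ¬ NonzeroPartialTransversal A (suc ρ)
    maximum M = 1+n≰n (maximal (suc ρ) M)
    bound : ∃ (EndpointCover (λ i j → ¬ A i j ≡ 0ℤ) r c) → 4 * (n + 1) ≤ (ρ + 2) * (ρ + 2)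
    bound (side , cover) = square-bound {e = count R} {f = count C}
      (line-cover-bound A (λ i → sum≡1 (A i) (rows i)) (λ j → sum≡1 (λ i → A i j) (cols j))
        (λ i j → entry≥-1 (entries i j)) R C (EndpointCover⇒image-cover cover))
      (count-endpoint-images≤ side r c)
      where
        R C : Fin n → Bool
        R = image (not ∘ side) r
        C = image side c
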